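{- Let $v\geq 2$, and let $G$ be a maximal weakly $(2,v)$-clique-partitioned graph. Then $G$ is isomorphic to $\Gamma'(2,v)$.
   Context: A $v$-clique is a set of $v$ pairwise adjacent vertices. A graph of order $nv$ is weakly $(n,v)$-clique-partitioned if its vertex set can be decomposed in a unique way into $n$ vertex-disjoint $v$-cliques. Every weakly $(n,v)$-clique-partitioned graph has at most $\binom{nv}{2}-\frac{n(n-1)v}{2}$ edges; one is called maximal if it has exactly this many edges. The graph $\Gamma'(n,v)$ has vertex set $\{(i,j):0\leq i\leq n-1,\ 0\leq j\leq v-1\}$ and is obtained from the complete graph on this vertex set by removing all edges joining $(i,0)$ to $(k,\ell)$ for all $0\leq i\leq n-2$, $i<k\leq n-1$, $0\leq \ell\leq v-1$. -}

module Defs where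

open import Data.Nat using (ℕ; zero; suc; _+_; _*_; _∸_; _/_; _<_; _<?_)
open import Data.Nat.Combinatorics using (_C_)
open import Data.Fin using (Fin; toℕ; _≟_)
open import Data.Fin.Properties using () renaming (_≟_ to _≟ᶠ_)
open import Data.Bool using (Bool; true; false; T; _∧_; _∨_; not)
open import Data.List using (List; length; filter; map)
open import Data.Nat.ListAction using (sum)
open import Data.List.Base using ()
open import Data.Fin.Base using ()
open import Data.List using (allFin)
open import Data.Product using (Σ; _×_; _,_)
open import Relation.Nullary using (¬_; does)
open import Relation.Nullary.Decidable using (_×-dec_)
open import Relation.Binary.PropositionalEquality using (_≡_; _≢_)
open import Function.Bundles using (_↔_; Inverse)

record Graph (V : Set) : Set where
  field
    adj    : V → V → Bool
    sym    : ∀ x y → adj x y ≡ adj y x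
    irrefl : ∀ x → adj x x ≡ false
open Graph public

edgeCount : {N : ℕ} → Graph (Fin N) → ℕ
edgeCount {N} G =
  sum (map (λ x → length (filter (λ y → (toℕ x <? toℕ y) ×-dec (adj G x y Data.Bool.≟ true)) (allFin N)))
           (allFin N))

-- A decomposition of the vertex set Fin (n * v) into n vertex-disjoint v-cliques,
-- encoded by the map sending each vertex to (the label of) its clique.
record CliquePartition (n v : ℕ) (G : Graph (Fin (n * v))) : Set where
  field
    part     : Fin (n * v) → Fin n
    partSize : ∀ i → length (filter (λ x → part x ≟ᶠ i) (allFin (n * v))) ≡ v
    isClique : ∀ x y → x ≢ y → part x ≡ part y → adj G x y ≡ true
open CliquePartition public

-- Two clique partitions are the same decomposition iff they have the same blocks,
-- i.e. induce the same equivalence relation (labels of the cliques are irrelevant).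
SameDecomposition : {n v : ℕ} {G : Graph (Fin (n * v))} → CliquePartition n v G → CliquePartition n v G → Set
SameDecomposition P Q = ∀ x y → (part P x ≡ part P y → part Q x ≡ part Q y)
                               × (part Q x ≡ part Q y → part P x ≡ part P y)

WeaklyCliquePartitioned : (n v : ℕ) → Graph (Fin (n * v)) → Set
WeaklyCliquePartitioned n v G =
  Σ (CliquePartition n v G) λ P → ∀ (Q : CliquePartition n v G) → SameDecomposition P Q

MaximalWeaklyCliquePartitioned : (n v : ℕ) → Graph (Fin (n * v)) → Set
MaximalWeaklyCliquePartitioned n v G =
  WeaklyCliquePartitioned n v G × (edgeCount G ≡ ((n * v) C 2) ∸ ((n * (n ∸ 1) * v) / 2))

removedΓ' : {n v : ℕ} → Fin n × Fin v → Fin n × Fin v → Bool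
removedΓ' (i , a) (k , b) =
    (does (toℕ a Data.Nat.≟ 0) ∧ does (toℕ i <? toℕ k))
  ∨ (does (toℕ b Data.Nat.≟ 0) ∧ does (toℕ k <? toℕ i))

adjΓ' : {n v : ℕ} → Fin n × Fin v → Fin n × Fin v → Bool
adjΓ' (i , a) (k , b) =
  not (does (i ≟ᶠ k) ∧ does (a ≟ᶠ b)) ∧ not (removedΓ' (i , a) (k , b))

Isomorphic : {V W : Set} → Graph V → (W → W → Bool) → Set
Isomorphic {V} {W} G H =
  Σ (V ↔ W) λ σ → ∀ x y → adj G x y ≡ H (Inverse.to σ x) (Inverse.to σ y)

module Submission where

-- Let s be the two-clique decomposition of G. Maximality leaves exactly v non-edges, all running
-- between the two cliques. If a vertex a of one clique and a vertex b of the other both lay on no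
-- non-edge, exchanging a and b would give a second decomposition. Hence, up to swapping the
-- cliques, every vertex of the first clique lies on a non-edge, and then (there being only v
-- non-edges) on exactly one. If a vertex b of the second clique lies on k non-edges with
-- 0 < k < v, then the v − k neighbours of b in the first clique, b itself and k − 1 vertices of
-- the second clique lying on no non-edge form a v-clique whose complement is again a clique, a
-- second decomposition. So some b is non-adjacent to the whole first clique and the non-edges
-- form the star at b, i.e. G ≅ Γ′(2,v).

open import Defs hiding (sym)
open import Data.Nat using (ℕ; _≤_; _*_)
open import Data.Fin using (Fin)

import Data.Bool as Bool
open import Data.Bool.Base using (Bool; true; false; _∧_; _∨_; not; if_then_else_)
open import Data.Bool.Properties
  using (∧-conicalˡ; ∧-conicalʳ; ∧-identityʳ; ∧-zeroʳ; ∨-identityʳ; not-involutive; not-injective)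
open import Data.Empty using (⊥; ⊥-elim)
open import Data.Fin.Base using (toℕ; fromℕ<; punchOut) renaming (zero to fzero; suc to fsuc)
open import Data.Fin.Properties
  using (_≟_; any?; toℕ-injective; toℕ-fromℕ<; fromℕ<-injective; pigeonhole; punchOut-injective; *↔×)
open import Data.List.Base using (length; filter; map; tabulate; allFin)
open import Data.Nat using (_<?_)
open import Data.Nat.Base using (zero; suc; _+_; _∸_; _<_; z≤n; s≤s; s≤s⁻¹)
open import Data.Nat.Combinatorics using (_C_; nC1≡n; nCk+nC[k+1]≡[n+1]C[k+1])
open import Data.Nat.DivMod using (_/_; m*n/n≡m)
import Data.Nat.ListAction as List
import Data.Nat.Properties as ℕ
open import Data.Product.Base using (∃; _×_; _,_; proj₁; proj₂)
open import Data.Sum.Base using (inj₁; inj₂)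
open import Function.Base using (_∘_; id)
open import Function.Bundles using (_↔_; Inverse; mk↔ₛ′; _⇔_; mk⇔; Equivalence)
open import Function.Definitions using (Injective)
open import Relation.Binary.Definitions using (tri<; tri≈; tri>)
open import Relation.Binary.PropositionalEquality
open import Relation.Nullary.Decidable
  using (Dec; yes; no; does; dec-true; dec-false; does-⇔; decidable-stable; _×-dec_)
open import Relation.Nullary.Negation using (contradiction)
open import Relation.Unary using (Decidable)

open import Algebra.Properties.CommutativeMonoid.Sum ℕ.+-0-commutativeMonoid
  using (sum; ∑-distrib-+; ∑-comm; sum-cong-≗; sum-replicate-zero)

private
  variable
    n : ℕ

-- Sums and counting over Fin

sum-mono-≤ : {f g : Fin n → ℕ} → (∀ x → f x ≤ g x) → sum f ≤ sum g
sum-mono-≤ {zero}  f≤g = z≤n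
sum-mono-≤ {suc n} f≤g = ℕ.+-mono-≤ (f≤g fzero) (sum-mono-≤ (f≤g ∘ fsuc))

sum-mono-< : {f g : Fin n → ℕ} → (∀ x → f x ≤ g x) → ∀ w → f w < g w → sum f < sum g
sum-mono-< {suc n} f≤g fzero    fw<gw = ℕ.+-mono-<-≤ fw<gw (sum-mono-≤ (f≤g ∘ fsuc))
sum-mono-< {suc n} f≤g (fsuc w) fw<gw = ℕ.+-mono-≤-< (f≤g fzero) (sum-mono-< (f≤g ∘ fsuc) w fw<gw)

sum-mono-≡⇒≡ : {f g : Fin n → ℕ} → (∀ x → f x ≤ g x) → sum f ≡ sum g → ∀ x → f x ≡ g x
sum-mono-≡⇒≡ f≤g Σf≡Σg x with ℕ.m≤n⇒m<n∨m≡n (f≤g x)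
... | inj₁ fx<gx = contradiction Σf≡Σg (ℕ.<⇒≢ (sum-mono-< f≤g x fx<gx))
... | inj₂ fx≡gx = fx≡gx

sum>0⇒∃ : (f : Fin n → ℕ) → 0 < sum f → ∃ λ x → 0 < f x
sum>0⇒∃ {suc n} f Σf>0 with f fzero in f0
... | suc _ = fzero , subst (0 <_) (sym f0) (s≤s z≤n)
... | zero  = let x , fx>0 = sum>0⇒∃ (f ∘ fsuc) Σf>0 in fsuc x , fx>0

does⇒ : {P : Set} (P? : Dec P) → does P? ≡ true → P
does⇒ (yes p) _ = p

does-≟-true : ∀ b → does (b Bool.≟ true) ≡ b
does-≟-true true  = refl
does-≟-true false = refl

does-≟-false : ∀ b → does (b Bool.≟ false) ≡ not b
does-≟-false true  = refl
does-≟-false false = refl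

not≡true⇒false : ∀ {a} → not a ≡ true → a ≡ false
not≡true⇒false {false} _ = refl

infix 7 _==_ _<ᵇ_

_==_ : Fin n → Fin n → Bool
x == y = does (x ≟ y)

_<ᵇ_ : Fin n → Fin n → Bool
x <ᵇ y = does (toℕ x <? toℕ y)

==-refl : (x : Fin n) → (x == x) ≡ true
==-refl x = dec-true (x ≟ x) refl

==-≢ : {x y : Fin n} → x ≢ y → (x == y) ≡ false
==-≢ {x = x} {y} = dec-false (x ≟ y)

==⇒≡ : {x y : Fin n} → (x == y) ≡ true → x ≡ y
==⇒≡ {x = x} {y} = does⇒ (x ≟ y)

<ᵇ⇒≢ : {x y : Fin n} → x <ᵇ y ≡ true → x ≢ y
<ᵇ⇒≢ {x = x} x<x refl = contradiction (trans (sym x<x) (dec-false (toℕ x <? toℕ x) (ℕ.<-irrefl refl))) λ ()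

infix 4 _⊆_

_⊆_ : (Fin n → Bool) → (Fin n → Bool) → Set
p ⊆ q = ∀ x → p x ≡ true → q x ≡ true

∁ : (Fin n → Bool) → Fin n → Bool
∁ p x = not (p x)

true≢false : (p : Fin n → Bool) {x y : Fin n} → p x ≡ true → p y ≡ false → x ≢ y
true≢false p px py refl = contradiction (trans (sym px) py) λ ()

𝟙 : Bool → ℕ
𝟙 true  = 1
𝟙 false = 0

𝟙-mono : ∀ a b → (a ≡ true → b ≡ true) → 𝟙 a ≤ 𝟙 b
𝟙-mono false b     _   = z≤n
𝟙-mono true  true  _   = s≤s z≤n
𝟙-mono true  false a⇒b = contradiction (a⇒b refl) λ ()

𝟙-≤ : ∀ a {m} → (a ≡ true → 0 < m) → 𝟙 a ≤ m
𝟙-≤ true  a⇒m>0 = a⇒m>0 refl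
𝟙-≤ false _     = z≤n

count : (Fin n → Bool) → ℕ
count p = sum (λ x → 𝟙 (p x))

count-cong : {p q : Fin n → Bool} → (∀ x → p x ≡ q x) → count p ≡ count q
count-cong p≗q = sum-cong-≗ (cong 𝟙 ∘ p≗q)

count-false : ∀ n → count {n} (λ _ → false) ≡ 0
count-false = sum-replicate-zero

count-true : count {n} (λ _ → true) ≡ n
count-true {zero}  = refl
count-true {suc n} = cong suc count-true

count-∨ : (p q : Fin n → Bool) → (∀ x → p x ∧ q x ≡ false) →
          count (λ x → p x ∨ q x) ≡ count p + count q
count-∨ p q disjoint = trans (sum-cong-≗ λ x → 𝟙-∨ (p x) (q x) (disjoint x))
                             (∑-distrib-+ (λ x → 𝟙 (p x)) (λ x → 𝟙 (q x)))
  where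
  𝟙-∨ : ∀ a b → a ∧ b ≡ false → 𝟙 (a ∨ b) ≡ 𝟙 a + 𝟙 b
  𝟙-∨ true  false _ = refl
  𝟙-∨ false b     _ = refl

count-∨-⊆ : {p q r : Fin n → Bool} → p ⊆ r → q ⊆ ∁ r → count (λ x → p x ∨ q x) ≡ count p + count q
count-∨-⊆ {p = p} {q} p⊆r q⊆∁r = count-∨ p q disjoint
  where
  disjoint : ∀ x → p x ∧ q x ≡ false
  disjoint x with p x in px | q x in qx
  ... | false | _     = refl
  ... | true  | false = refl
  ... | true  | true  = contradiction (subst (λ b → not b ≡ true) (p⊆r x px) (q⊆∁r x qx)) λ ()

count-split : (p q : Fin n → Bool) →
              count p ≡ count (λ x → p x ∧ q x) + count (λ x → p x ∧ not (q x))
count-split p q = trans (sum-cong-≗ λ x → 𝟙-split (p x) (q x))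
                        (∑-distrib-+ (λ x → 𝟙 (p x ∧ q x)) (λ x → 𝟙 (p x ∧ not (q x))))
  where
  𝟙-split : ∀ a b → 𝟙 a ≡ 𝟙 (a ∧ b) + 𝟙 (a ∧ not b)
  𝟙-split true  true  = refl
  𝟙-split true  false = refl
  𝟙-split false b     = refl

count-complement : (p : Fin n → Bool) → count p + count (∁ p) ≡ n
count-complement {n} p = trans (sym (count-split (λ _ → true) p)) (count-true {n})

count-mono-< : {p q : Fin n → Bool} → p ⊆ q → ∀ w → p w ≡ false → q w ≡ true → count p < count q
count-mono-< {p = p} {q} p⊆q w pw qw =
  sum-mono-< (λ x → 𝟙-mono (p x) (q x) (p⊆q x)) w
             (subst₂ (λ a b → 𝟙 a < 𝟙 b) (sym pw) (sym qw) (s≤s z≤n))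

⊆∧count≡⇒⊇ : {p q : Fin n → Bool} → p ⊆ q → count p ≡ count q → q ⊆ p
⊆∧count≡⇒⊇ {p = p} p⊆q #p≡#q x qx with p x in px
... | true  = refl
... | false = contradiction #p≡#q (ℕ.<⇒≢ (count-mono-< p⊆q x px qx))

count≡0⇒false : (p : Fin n → Bool) → count p ≡ 0 → ∀ x → p x ≡ false
count≡0⇒false {n} p #p≡0 x with p x in px
... | false = refl
... | true  = ⊥-elim (ℕ.<-irrefl (sym #p≡0) (subst (_< count p) (count-false n) (count-mono-< (λ _ ()) x refl px)))

count>0⇒∃ : (p : Fin n → Bool) → 0 < count p → ∃ λ x → p x ≡ true
count>0⇒∃ p #p>0 = let x , 𝟙px>0 = sum>0⇒∃ (𝟙 ∘ p) #p>0 in x , 𝟙>0⇒true (p x) 𝟙px>0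
  where
  𝟙>0⇒true : ∀ a → 0 < 𝟙 a → a ≡ true
  𝟙>0⇒true true _ = refl

sum-== : (f : Fin n → ℕ) (b : Fin n) → sum (λ y → if y == b then f y else 0) ≡ f b
sum-== {suc n} f fzero    = trans (cong (f fzero +_) (sum-replicate-zero n)) (ℕ.+-identityʳ _)
sum-== {suc n} f (fsuc b) = sum-== (f ∘ fsuc) b

count-∧-== : (p : Fin n → Bool) (x : Fin n) → count (λ y → p y ∧ (y == x)) ≡ 𝟙 (p x)
count-∧-== p x = trans (sum-cong-≗ λ y → 𝟙-∧ (p y) (y == x)) (sum-== (𝟙 ∘ p) x)
  where
  𝟙-∧ : ∀ a b → 𝟙 (a ∧ b) ≡ (if b then 𝟙 a else 0)
  𝟙-∧ a true  = cong 𝟙 (∧-identityʳ a)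
  𝟙-∧ a false = cong 𝟙 (∧-zeroʳ a)

count-singleton : (x : Fin n) → count (_== x) ≡ 1
count-singleton = count-∧-== (λ _ → true)

count-remove : (p : Fin n → Bool) {x : Fin n} → p x ≡ true → count p ≡ suc (count (λ y → p y ∧ not (y == x)))
count-remove p {x} px = trans (count-split p (_== x))
  (cong (_+ count (λ y → p y ∧ not (y == x))) (trans (count-∧-== p x) (cong 𝟙 px)))

count≡1⇒unique : (p : Fin n → Bool) {x y : Fin n} → count p ≡ 1 → p x ≡ true → p y ≡ true → y ≡ x
count≡1⇒unique p {x} {y} #p≡1 px py with y ≟ x
... | yes y≡x = y≡x
... | no  y≢x = contradiction (count≡0⇒false _ (ℕ.suc-injective (trans (sym (count-remove p px)) #p≡1)) y)
                             (subst₂ (λ a b → a ∧ not b ≢ false) (sym py) (sym (==-≢ y≢x)) λ ())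

count+≤sum : (f : Fin n → ℕ) (p : Fin n → Bool) (b : Fin n) → p b ≡ false →
             (∀ y → p y ≡ true → 0 < f y) → count p + f b ≤ sum f
count+≤sum f p b pb p⇒f>0 = begin
  count p + f b
    ≡⟨ cong (count p +_) (sum-== f b) ⟨
  count p + sum (λ y → if y == b then f y else 0)
    ≡⟨ ∑-distrib-+ (𝟙 ∘ p) (λ y → if y == b then f y else 0) ⟨
  sum (λ y → 𝟙 (p y) + (if y == b then f y else 0))
    ≤⟨ sum-mono-≤ pointwise ⟩
  sum f ∎
  where
  open ℕ.≤-Reasoning
  pointwise : ∀ y → 𝟙 (p y) + (if y == b then f y else 0) ≤ f y
  pointwise y with y ≟ b
  ... | yes refl rewrite pb = ℕ.≤-refl
  ... | no  _    = ℕ.≤-trans (ℕ.≤-reflexive (ℕ.+-identityʳ _)) (𝟙-≤ (p y) (p⇒f>0 y))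

∃⊆-with-count : (p : Fin n → Bool) (r : ℕ) → r ≤ count p → ∃ λ q → q ⊆ p × count q ≡ r
∃⊆-with-count {zero}  p zero    _ = p , (λ ()) , refl
∃⊆-with-count {suc n} p r r≤#p with p fzero in p0
∃⊆-with-count {suc n} p zero r≤#p | true = (λ _ → false) , (λ _ ()) , count-false (suc n)
∃⊆-with-count {suc n} p (suc r) (s≤s r≤#p) | true =
  let q , q⊆p , #q≡r = ∃⊆-with-count (p ∘ fsuc) r r≤#p
  in (λ { fzero → true ; (fsuc x) → q x }) , (λ { fzero _ → p0 ; (fsuc x) → q⊆p x }) , cong suc #q≡r
∃⊆-with-count {suc n} p r r≤#p | false =
  let q , q⊆p , #q≡r = ∃⊆-with-count (p ∘ fsuc) r r≤#p
  in (λ { fzero → false ; (fsuc x) → q x }) , (λ { fzero () ; (fsuc x) → q⊆p x }) , #q≡r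

count-<ᵇ-pairs : ∀ n → sum (λ (x : Fin n) → count (x <ᵇ_)) ≡ n C 2
count-<ᵇ-pairs zero    = refl
count-<ᵇ-pairs (suc n) = begin
  count {n} (λ _ → true) + sum (λ (x : Fin n) → count (x <ᵇ_))
    ≡⟨ cong₂ _+_ (trans count-true (sym (nC1≡n n))) (count-<ᵇ-pairs n) ⟩
  n C 1 + n C 2
    ≡⟨ nCk+nC[k+1]≡[n+1]C[k+1] n 1 ⟩
  suc n C 2 ∎
  where open ≡-Reasoning

count-<ᵇ-both-ways : (r : Fin n → Fin n → Bool) → (∀ x → r x x ≡ false) →
                     sum (λ x → count (λ y → x <ᵇ y ∧ r x y)) + sum (λ x → count (λ y → x <ᵇ y ∧ r y x))
                     ≡ sum (λ x → count (r x))
count-<ᵇ-both-ways r r-irrefl = begin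
  sum (λ x → count (λ y → x <ᵇ y ∧ r x y)) + sum (λ x → count (λ y → x <ᵇ y ∧ r y x))
    ≡⟨ cong (sum (λ x → count (λ y → x <ᵇ y ∧ r x y)) +_) (∑-comm (λ x y → 𝟙 (x <ᵇ y ∧ r y x))) ⟩
  sum (λ x → count (λ y → x <ᵇ y ∧ r x y)) + sum (λ x → count (λ y → y <ᵇ x ∧ r x y))
    ≡⟨ ∑-distrib-+ (λ x → count (λ y → x <ᵇ y ∧ r x y)) (λ x → count (λ y → y <ᵇ x ∧ r x y)) ⟨
  sum (λ x → count (λ y → x <ᵇ y ∧ r x y) + count (λ y → y <ᵇ x ∧ r x y))
    ≡⟨ sum-cong-≗ (λ x → ∑-distrib-+ (λ y → 𝟙 (x <ᵇ y ∧ r x y)) (λ y → 𝟙 (y <ᵇ x ∧ r x y))) ⟨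
  sum (λ x → sum (λ y → 𝟙 (x <ᵇ y ∧ r x y) + 𝟙 (y <ᵇ x ∧ r x y)))
    ≡⟨ sum-cong-≗ (λ x → sum-cong-≗ (𝟙-trichotomy x)) ⟩
  sum (λ x → count (r x)) ∎
  where
  open ≡-Reasoning
  𝟙-trichotomy : ∀ x y → 𝟙 (x <ᵇ y ∧ r x y) + 𝟙 (y <ᵇ x ∧ r x y) ≡ 𝟙 (r x y)
  𝟙-trichotomy x y with ℕ.<-cmp (toℕ x) (toℕ y)
  ... | tri< x<y _ y≮x = trans (cong₂ (λ a b → 𝟙 (a ∧ r x y) + 𝟙 (b ∧ r x y))
                                       (dec-true (toℕ x <? toℕ y) x<y) (dec-false (toℕ y <? toℕ x) y≮x))
                                (ℕ.+-identityʳ _)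
  ... | tri> x≮y _ y<x = cong₂ (λ a b → 𝟙 (a ∧ r x y) + 𝟙 (b ∧ r x y))
                               (dec-false (toℕ x <? toℕ y) x≮y) (dec-true (toℕ y <? toℕ x) y<x)
  ... | tri≈ _ x≡y _ rewrite toℕ-injective x≡y | r-irrefl y | ∧-zeroʳ (y <ᵇ y) = refl

length-filter-tabulate : {A : Set} (f : Fin n → A) {P : A → Set} (P? : Decidable P) →
                         length (filter P? (tabulate f)) ≡ count (λ x → does (P? (f x)))
length-filter-tabulate {zero}  f P? = refl
length-filter-tabulate {suc n} f P? with does (P? (f fzero))
... | true  = cong suc (length-filter-tabulate (f ∘ fsuc) P?)
... | false = length-filter-tabulate (f ∘ fsuc) P?

sum-map-tabulate : {A : Set} (f : Fin n → A) (g : A → ℕ) → List.sum (map g (tabulate f)) ≡ sum (g ∘ f)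
sum-map-tabulate {zero}  f g = refl
sum-map-tabulate {suc n} f g = cong (g (f fzero) +_) (sum-map-tabulate (f ∘ fsuc) g)

-- Injections and ranks on Fin

injective⇒surjective : (f : Fin n → Fin n) → Injective _≡_ _≡_ f → ∀ y → ∃ λ x → f x ≡ y
injective⇒surjective {zero}  f f-inj ()
injective⇒surjective {suc n} f f-inj y with any? (λ x → f x ≟ y)
... | yes hit = hit
... | no  ∄x  =
  let i , j , i<j , gi≡gj = pigeonhole (ℕ.n<1+n n) (λ x → punchOut (y≢f x))
  in contradiction (f-inj (punchOut-injective (y≢f i) (y≢f j) gi≡gj)) (ℕ.<⇒≢ i<j ∘ cong toℕ)
  where
  y≢f : ∀ x → y ≢ f x
  y≢f x y≡fx = ∄x (x , sym y≡fx)

injective⇒↔ : {A : Set} → Fin n ↔ A → (f : Fin n → A) → Injective _≡_ _≡_ f → Fin n ↔ A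
injective⇒↔ e f f-inj = mk↔ₛ′ f f⁻¹ f∘f⁻¹ (λ x → f-inj (f∘f⁻¹ (f x)))
  where
  open Inverse e using (to; from; strictlyInverseˡ)
  from-inj : Injective _≡_ _≡_ from
  from-inj {a} {b} fa≡fb = trans (sym (strictlyInverseˡ a)) (trans (cong to fa≡fb) (strictlyInverseˡ b))
  hit : ∀ a → ∃ λ x → from (f x) ≡ from a
  hit a = injective⇒surjective (from ∘ f) (f-inj ∘ from-inj) (from a)
  f⁻¹ : _ → Fin _
  f⁻¹ a = proj₁ (hit a)
  f∘f⁻¹ : ∀ a → f (f⁻¹ a) ≡ a
  f∘f⁻¹ a = from-inj (proj₂ (hit a))

module Rank {N : ℕ} (S : Fin N → Bool) (key : Fin N → ℕ) (key-injective : Injective _≡_ _≡_ key) where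

  sameSide : Fin N → Fin N → Bool
  sameSide z x = does (S z Bool.≟ S x)

  below : Fin N → Fin N → Bool
  below z x = does (key z <? key x) ∧ sameSide z x

  rank : Fin N → ℕ
  rank x = count (λ z → below z x)

  below-irrefl : ∀ x → below x x ≡ false
  below-irrefl x = cong (_∧ sameSide x x) (dec-false (key x <? key x) (ℕ.<-irrefl refl))

  below-intro : ∀ {z x} → key z < key x → S z ≡ S x → below z x ≡ true
  below-intro {z} {x} z<x sz≡sx = cong₂ _∧_ (dec-true (key z <? key x) z<x) (dec-true (S z Bool.≟ S x) sz≡sx)

  rank<∣side∣ : ∀ x → rank x < count (λ z → sameSide z x)
  rank<∣side∣ x = count-mono-< (λ z → ∧-conicalʳ _ _) x (below-irrefl x) (dec-true (S x Bool.≟ S x) refl)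

  rank-mono-< : ∀ {x y} → key x < key y → S x ≡ S y → rank x < rank y
  rank-mono-< {x} {y} x<y sx≡sy = count-mono-< below-x⊆below-y x (below-irrefl x) (below-intro x<y sx≡sy)
    where
    below-x⊆below-y : (λ z → below z x) ⊆ (λ z → below z y)
    below-x⊆below-y z z<x = below-intro
      (ℕ.<-trans (does⇒ (key z <? key x) (∧-conicalˡ _ _ z<x)) x<y)
      (trans (does⇒ (S z Bool.≟ S x) (∧-conicalʳ _ _ z<x)) sx≡sy)

  rank-injective : ∀ {x y} → S x ≡ S y → rank x ≡ rank y → x ≡ y
  rank-injective {x} {y} sx≡sy rx≡ry with ℕ.<-cmp (key x) (key y)
  ... | tri< x<y _ _   = contradiction rx≡ry (ℕ.<⇒≢ (rank-mono-< x<y sx≡sy))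
  ... | tri≈ _ kx≡ky _ = key-injective kx≡ky
  ... | tri> _ _ y<x   = contradiction (sym rx≡ry) (ℕ.<⇒≢ (rank-mono-< y<x (sym sx≡sy)))

  rank≡0 : ∀ {x} → key x ≡ 0 → rank x ≡ 0
  rank≡0 {x} kx≡0 = trans (count-cong λ z → cong (_∧ sameSide z x)
                                    (dec-false (key z <? key x) (ℕ.n≮0 ∘ subst (key z <_) kx≡0)))
                          (count-false N)

  rank>0 : ∀ {z x} → key z < key x → S z ≡ S x → 0 < rank x
  rank>0 {x = x} z<x sz≡sx =
    subst (0 <_) (sym (count-remove (λ z → below z x) (below-intro z<x sz≡sx))) (s≤s z≤n)

sideIndex : Bool → Fin 2
sideIndex b = if b then fzero else fsuc fzero

sideIndex-injective : Injective _≡_ _≡_ sideIndex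
sideIndex-injective {true}  {true}  _ = refl
sideIndex-injective {false} {false} _ = refl

sideIndex-<⇔ : ∀ {a b} → toℕ (sideIndex a) < toℕ (sideIndex b) ⇔ (a ≡ true × b ≡ false)
sideIndex-<⇔ {true}  {false} = mk⇔ (λ _ → refl , refl) (λ _ → s≤s z≤n)
sideIndex-<⇔ {true}  {true}  = mk⇔ (λ ()) (λ ())
sideIndex-<⇔ {false} {true}  = mk⇔ (λ ()) (λ ())
sideIndex-<⇔ {false} {false} = mk⇔ (λ { (s≤s ()) }) (λ ())

sideIndex-==0 : ∀ b → (sideIndex b == fzero) ≡ b
sideIndex-==0 true  = refl
sideIndex-==0 false = refl

sideIndex-==1 : ∀ b → (sideIndex b == fsuc fzero) ≡ not b
sideIndex-==1 true  = refl
sideIndex-==1 false = refl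

==0-injective : ∀ {i j : Fin 2} → (i == fzero) ≡ (j == fzero) → i ≡ j
==0-injective {fzero}      {fzero}      _ = refl
==0-injective {fsuc fzero} {fsuc fzero} _ = refl

not-==0 : ∀ (i : Fin 2) → not (i == fzero) ≡ (i == fsuc fzero)
not-==0 fzero        = refl
not-==0 (fsuc fzero) = refl

-- Bisections of a graph into two cliques

module _ {N : ℕ} (G : Graph (Fin N)) where

  nonEdgeCount : ℕ
  nonEdgeCount = sum (λ x → count (λ y → x <ᵇ y ∧ not (adj G x y)))

  edgeCount≡sum : edgeCount G ≡ sum (λ x → count (λ y → x <ᵇ y ∧ adj G x y))
  edgeCount≡sum = trans (sum-map-tabulate {N} id _) (sum-cong-≗ λ x →
    trans (length-filter-tabulate id (λ y → (toℕ x <? toℕ y) ×-dec (adj G x y Bool.≟ true)))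
          (count-cong λ y → cong (x <ᵇ y ∧_) (does-≟-true (adj G x y))))

  edgeCount+nonEdgeCount : edgeCount G + nonEdgeCount ≡ N C 2
  edgeCount+nonEdgeCount = begin
    edgeCount G + nonEdgeCount
      ≡⟨ cong (_+ nonEdgeCount) edgeCount≡sum ⟩
    sum (λ x → count (λ y → x <ᵇ y ∧ adj G x y)) + nonEdgeCount
      ≡⟨ ∑-distrib-+ (λ x → count (λ y → x <ᵇ y ∧ adj G x y))
                     (λ x → count (λ y → x <ᵇ y ∧ not (adj G x y))) ⟨
    sum (λ x → count (λ y → x <ᵇ y ∧ adj G x y) + count (λ y → x <ᵇ y ∧ not (adj G x y)))
      ≡⟨ sum-cong-≗ (λ x → count-split {N} (x <ᵇ_) (adj G x)) ⟨
    sum (λ (x : Fin N) → count (x <ᵇ_))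
      ≡⟨ count-<ᵇ-pairs N ⟩
    N C 2 ∎
    where open ≡-Reasoning

  SidesAreCliques : (Fin N → Bool) → Set
  SidesAreCliques s = ∀ x y → x ≢ y → s x ≡ s y → adj G x y ≡ true

  record IsBisection (v : ℕ) (s : Fin N → Bool) : Set where
    field
      ∣s∣≡v   : count s ≡ v
      ∣∁s∣≡v  : count (∁ s) ≡ v
      cliques : SidesAreCliques s

  IsBisection-∁ : ∀ {v s} → IsBisection v s → IsBisection v (∁ s)
  IsBisection-∁ {s = s} bis = record
    { ∣s∣≡v   = ∣∁s∣≡v
    ; ∣∁s∣≡v  = trans (count-cong (not-involutive ∘ s)) ∣s∣≡v
    ; cliques = λ x y x≢y ∁sx≡∁sy → cliques x y x≢y (not-injective ∁sx≡∁sy)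
    }
    where open IsBisection bis

  SameSides : (s t : Fin N → Bool) → Set
  SameSides s t = ∀ x y → s x ≡ s y → t x ≡ t y

  CrossCompatible : (s t : Fin N → Bool) → Set
  CrossCompatible s t = ∀ x y → s x ≡ true → s y ≡ false → t x ≡ t y → adj G x y ≡ true

  crossCompatible⇒IsBisection : ∀ {v s t} → IsBisection v s → count t ≡ v → CrossCompatible s t →
                                IsBisection v t
  crossCompatible⇒IsBisection {v} {s} {t} bis ∣t∣≡v compatible = record
    { ∣s∣≡v = ∣t∣≡v ; ∣∁s∣≡v = ∣∁t∣≡v ; cliques = t-cliques }
    where
    open IsBisection bis
    ∣∁t∣≡v : count (∁ t) ≡ v
    ∣∁t∣≡v = ℕ.+-cancelˡ-≡ v (count (∁ t)) v (begin
      v + count (∁ t)       ≡⟨ cong (_+ count (∁ t)) ∣t∣≡v ⟨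
      count t + count (∁ t) ≡⟨ count-complement t ⟩
      N                     ≡⟨ count-complement s ⟨
      count s + count (∁ s) ≡⟨ cong₂ _+_ ∣s∣≡v ∣∁s∣≡v ⟩
      v + v                 ∎)
      where open ≡-Reasoning
    t-cliques : SidesAreCliques t
    t-cliques x y x≢y tx≡ty with s x in sx | s y in sy
    ... | true  | false = compatible x y sx sy tx≡ty
    ... | false | true  = trans (Graph.sym G x y) (compatible y x sy sx (sym tx≡ty))
    ... | true  | true  = cliques x y x≢y (trans sx (sym sy))
    ... | false | false = cliques x y x≢y (trans sx (sym sy))

  module Across (s : Fin N → Bool) where

    missing : Fin N → Fin N → Bool
    missing x y = s x ∧ not (s y) ∧ not (adj G x y)

    missingFrom : Fin N → ℕ
    missingFrom x = count (missing x)

    missingTo : Fin N → ℕ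
    missingTo y = count (λ x → missing x y)

    crossNonEdges : ℕ
    crossNonEdges = sum missingFrom

    unmissed : Fin N → Bool
    unmissed y = does (missingTo y ℕ.≟ 0)

    missing-irrefl : ∀ x → missing x x ≡ false
    missing-irrefl x with s x
    ... | true  = refl
    ... | false = refl

    missing⇒ : ∀ {x y} → missing x y ≡ true → s x ≡ true × s y ≡ false × adj G x y ≡ false
    missing⇒ {x} {y} m with s x | s y | adj G x y
    missing⇒ refl | true | false | false = refl , refl , refl

    ¬missing⇒adj : ∀ {x y} → s x ≡ true → s y ≡ false → missing x y ≡ false → adj G x y ≡ true
    ¬missing⇒adj {x} {y} sx sy ¬m rewrite sx | sy with adj G x y
    ... | true = refl

    ¬adj⇒missing : ∀ {x y} → s x ≡ true → s y ≡ false → adj G x y ≡ false → missing x y ≡ true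
    ¬adj⇒missing sx sy ¬xy rewrite sx | sy | ¬xy = refl

    missed⇒∁s : ∀ {b} → 0 < missingTo b → s b ≡ false
    missed⇒∁s {b} b-missed = proj₁ (proj₂ (missing⇒ (proj₂ (count>0⇒∃ (λ x → missing x b) b-missed))))

    sum-missingTo : sum missingTo ≡ crossNonEdges
    sum-missingTo = ∑-comm (λ y x → 𝟙 (missing x y))

    nonEdgeCount≡crossNonEdges : SidesAreCliques s → nonEdgeCount ≡ crossNonEdges
    nonEdgeCount≡crossNonEdges cliques = begin
      nonEdgeCount
        ≡⟨ sum-cong-≗ (λ x → trans (sum-cong-≗ (𝟙-nonAdjacent x))
             (∑-distrib-+ (λ y → 𝟙 (x <ᵇ y ∧ missing x y)) (λ y → 𝟙 (x <ᵇ y ∧ missing y x)))) ⟩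
      sum (λ x → count (λ y → x <ᵇ y ∧ missing x y) + count (λ y → x <ᵇ y ∧ missing y x))
        ≡⟨ ∑-distrib-+ (λ x → count (λ y → x <ᵇ y ∧ missing x y))
                       (λ x → count (λ y → x <ᵇ y ∧ missing y x)) ⟩
      sum (λ x → count (λ y → x <ᵇ y ∧ missing x y)) + sum (λ x → count (λ y → x <ᵇ y ∧ missing y x))
        ≡⟨ count-<ᵇ-both-ways missing missing-irrefl ⟩
      crossNonEdges ∎
      where
      open ≡-Reasoning
      𝟙-nonAdjacent : ∀ x y → 𝟙 (x <ᵇ y ∧ not (adj G x y))
                              ≡ 𝟙 (x <ᵇ y ∧ missing x y) + 𝟙 (x <ᵇ y ∧ missing y x)
      𝟙-nonAdjacent x y with x <ᵇ y in x<y
      ... | false = refl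
      ... | true with s x in sx | s y in sy
      ...   | true  | false = sym (ℕ.+-identityʳ _)
      ...   | false | true  = cong (𝟙 ∘ not) (Graph.sym G x y)
      ...   | true  | true  = cong (𝟙 ∘ not) (cliques x y (<ᵇ⇒≢ x<y) (trans sx (sym sy)))
      ...   | false | false = cong (𝟙 ∘ not) (cliques x y (<ᵇ⇒≢ x<y) (trans sx (sym sy)))

  missing-∁ : (s : Fin N → Bool) → ∀ x y → Across.missing (∁ s) x y ≡ Across.missing s y x
  missing-∁ s x y with s x | s y
  ... | true  | true  = refl
  ... | true  | false = refl
  ... | false | true  = cong not (Graph.sym G x y)
  ... | false | false = refl

  crossNonEdges-∁ : (s : Fin N → Bool) → Across.crossNonEdges (∁ s) ≡ Across.crossNonEdges s
  crossNonEdges-∁ s = trans (sum-cong-≗ λ x → count-cong (missing-∁ s x)) (Across.sum-missingTo s)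

  -- The non-edges form a star

  IsStarAt : (Fin N → Bool) → Fin N → Set
  IsStarAt S c = ∀ x y → adj G x y ≡ not (x == y) ∧ not ((x == c ∧ not (S y)) ∨ (y == c ∧ not (S x)))

  record StarBisection (v : ℕ) : Set where
    field
      side        : Fin N → Bool
      centre      : Fin N
      bisection   : IsBisection v side
      centre-side : side centre ≡ true
      star        : IsStarAt side centre

  isStarAt-∁ : {s : Fin N → Bool} → SidesAreCliques s → ∀ {c} → s c ≡ false →
               (∀ x → s x ≡ true → adj G x c ≡ false) →
               (∀ x y → s x ≡ true → s y ≡ false → y ≢ c → adj G x y ≡ true) →
               IsStarAt (∁ s) c
  isStarAt-∁ {s} cliques {c} sc centre-missed others x y with x ≟ y
  ... | yes refl = Graph.irrefl G x
  ... | no  x≢y with s x in sx | s y in sy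
  ...   | true  | true  rewrite ==-≢ (true≢false s sx sc) | ==-≢ (true≢false s sy sc) =
    cliques x y x≢y (trans sx (sym sy))
  ...   | false | false rewrite ∧-zeroʳ (x == c) | ∧-zeroʳ (y == c) = cliques x y x≢y (trans sx (sym sy))
  ...   | true  | false with y ≟ c
  ...     | yes refl rewrite ∧-zeroʳ (x == y) = centre-missed x sx
  ...     | no  y≢c  rewrite ∧-zeroʳ (x == c) = others x y sx sy y≢c
  isStarAt-∁ {s} cliques {c} sc centre-missed others x y | no x≢y | false | true with x ≟ c
  ...     | yes refl = trans (Graph.sym G x y) (centre-missed y sy)
  ...     | no  x≢c  rewrite ∧-zeroʳ (y == c) = trans (Graph.sym G x y) (others y x sy sx x≢c)

  module UniqueBisection {v : ℕ} {s : Fin N → Bool} (2≤v : 2 ≤ v) (bis : IsBisection v s)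
                         (unique : ∀ t → IsBisection v t → SameSides s t)
                         (cross≡v : Across.crossNonEdges s ≡ v) where
    open IsBisection bis
    open Across s

    compatible-cannot-separate : (t : Fin N → Bool) → count t ≡ v → CrossCompatible s t →
                                 ∀ {x y} → s x ≡ s y → t x ≡ true → t y ≡ false → ⊥
    compatible-cannot-separate t ∣t∣≡v compatible {x} {y} sx≡sy tx ty = contradiction
      (trans (sym tx) (trans (unique t (crossCompatible⇒IsBisection bis ∣t∣≡v compatible) x y sx≡sy) ty)) λ ()

    ∃-missed : ∃ λ b → 0 < missingTo b
    ∃-missed = sum>0⇒∃ missingTo (subst (0 <_) (sym (trans sum-missingTo cross≡v)) (ℕ.≤-trans (s≤s z≤n) 2≤v))

    count-adjacent+missingTo : ∀ {b} → s b ≡ false → count (λ x → s x ∧ adj G x b) + missingTo b ≡ v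
    count-adjacent+missingTo {b} sb = trans
      (cong (count (λ x → s x ∧ adj G x b) +_)
            (count-cong λ x → cong (λ c → s x ∧ not c ∧ not (adj G x b)) sb))
      (trans (sym (count-split s (λ x → adj G x b))) ∣s∣≡v)

    ∃-unmissed-subset : ∀ {b k} → s b ≡ false → missingTo b ≡ suc k →
                        ∃ λ I → I ⊆ (λ y → (∁ s y ∧ not (y == b)) ∧ unmissed y) × count I ≡ k
    ∃-unmissed-subset {b} {k} sb ∣b∣≡1+k = ∃⊆-with-count _ k k≤#free
      where
      others : Fin N → Bool
      others y = ∁ s y ∧ not (y == b)
      #free #busy : ℕ
      #free = count (λ y → others y ∧ unmissed y)
      #busy = count (λ y → others y ∧ not (unmissed y))
      b-not-busy : others b ∧ not (unmissed b) ≡ false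
      b-not-busy rewrite ==-refl b = cong (_∧ not (unmissed b)) (∧-zeroʳ (∁ s b))
      busy-missed : ∀ y → others y ∧ not (unmissed y) ≡ true → 0 < missingTo y
      busy-missed y busy = ℕ.n≢0⇒n>0 λ ∣y∣≡0 →
        contradiction (trans (sym (cong not (dec-true (missingTo y ℕ.≟ 0) ∣y∣≡0))) (∧-conicalʳ _ _ busy)) λ ()
      #busy+1+k≤v : #busy + suc k ≤ v
      #busy+1+k≤v = subst₂ _≤_ (cong (#busy +_) ∣b∣≡1+k) (trans sum-missingTo cross≡v)
                             (count+≤sum missingTo _ b b-not-busy busy-missed)
      1+#free+#busy≡v : suc (#free + #busy) ≡ v
      1+#free+#busy≡v = trans (cong suc (sym (count-split others unmissed)))
                              (trans (sym (count-remove (∁ s) (cong not sb))) ∣∁s∣≡v)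
      k≤#free : k ≤ #free
      k≤#free = ℕ.+-cancelˡ-≤ #busy k #free (s≤s⁻¹ (begin
        suc (#busy + k)     ≡⟨ ℕ.+-suc #busy k ⟨
        #busy + suc k       ≤⟨ #busy+1+k≤v ⟩
        v                   ≡⟨ 1+#free+#busy≡v ⟨
        suc (#free + #busy) ≡⟨ cong suc (ℕ.+-comm #free #busy) ⟩
        suc (#busy + #free) ∎))
        where open ℕ.≤-Reasoning

    module Exchange {a b} (sa : s a ≡ true) (sb : s b ≡ false) where

      t : Fin N → Bool
      t x = (s x ∧ not (x == a)) ∨ (x == b)

      t-on-s : ∀ {x} → s x ≡ true → t x ≡ not (x == a)
      t-on-s {x} sx rewrite sx | ==-≢ (true≢false s sx sb) = ∨-identityʳ _

      t-on-∁s : ∀ {y} → s y ≡ false → t y ≡ (y == b)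
      t-on-∁s sy rewrite sy = refl

      ∣t∣≡v : count t ≡ v
      ∣t∣≡v = begin
        count t                                          ≡⟨ count-∨-⊆ (λ x → ∧-conicalˡ _ _) b-on-∁s ⟩
        count (λ x → s x ∧ not (x == a)) + count (_== b) ≡⟨ cong₂ _+_ refl (count-singleton b) ⟩
        count (λ x → s x ∧ not (x == a)) + 1             ≡⟨ ℕ.+-comm _ 1 ⟩
        suc (count (λ x → s x ∧ not (x == a)))           ≡⟨ count-remove s sa ⟨
        count s                                          ≡⟨ ∣s∣≡v ⟩
        v                                                ∎
        where
        open ≡-Reasoning
        b-on-∁s : (_== b) ⊆ ∁ s
        b-on-∁s x x==b = subst (λ z → not (s z) ≡ true) (sym (==⇒≡ x==b)) (cong not sb)

      compatible : missingFrom a ≡ 0 → missingTo b ≡ 0 → CrossCompatible s t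
      compatible a-unmissing b-unmissed x y sx sy tx≡ty =
        by-cases (trans (sym (t-on-s sx)) (trans tx≡ty (t-on-∁s sy)))
        where
        by-cases : not (x == a) ≡ (y == b) → adj G x y ≡ true
        by-cases x≠a⇔y=b with x ≟ a | y ≟ b
        ... | yes refl | _        = ¬missing⇒adj sx sy (count≡0⇒false _ a-unmissing y)
        ... | no  _    | yes refl = ¬missing⇒adj sx sy (count≡0⇒false _ b-unmissed x)
        ... | no  _    | no  _    = contradiction x≠a⇔y=b λ ()

    unmissed-pair-⊥ : ∀ {a b} → s a ≡ true → missingFrom a ≡ 0 → s b ≡ false → missingTo b ≡ 0 → ⊥
    unmissed-pair-⊥ {a} sa a-unmissing sb b-unmissed =
      compatible-cannot-separate t ∣t∣≡v (compatible a-unmissing b-unmissed) (trans sa′ (sym sa))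
        (trans (t-on-s sa′) (∧-conicalʳ _ _ a′-other)) (trans (t-on-s sa) (cong not (==-refl a)))
      where
      open Exchange sa sb
      a′-on-side : ∃ λ a′ → s a′ ∧ not (a′ == a) ≡ true
      a′-on-side = count>0⇒∃ _
        (s≤s⁻¹ (ℕ.≤-trans 2≤v (ℕ.≤-reflexive (trans (sym ∣s∣≡v) (count-remove s sa)))))
      a′-other = proj₂ a′-on-side
      sa′ = ∧-conicalˡ _ _ a′-other

    module _ (missing-from-all : ∀ x → s x ≡ true → 0 < missingFrom x) where

      missingFrom≡1 : ∀ {x} → s x ≡ true → missingFrom x ≡ 1
      missingFrom≡1 {x} sx =
        sym (trans (cong 𝟙 (sym sx)) (sum-mono-≡⇒≡ (λ x → 𝟙-≤ (s x) (missing-from-all x))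
                                                   (trans ∣s∣≡v (sym cross≡v)) x))

      missed-once : ∀ {x y z} → missing x y ≡ true → missing x z ≡ true → z ≡ y
      missed-once mxy mxz = count≡1⇒unique (missing _) (missingFrom≡1 (proj₁ (missing⇒ mxy))) mxy mxz

      fully-missed⇒star : ∀ {b} → s b ≡ false → missingTo b ≡ v → IsStarAt (∁ s) b
      fully-missed⇒star {b} sb ∣b∣≡v = isStarAt-∁ cliques sb centre-missed others
        where
        all-miss : s ⊆ (λ x → missing x b)
        all-miss = ⊆∧count≡⇒⊇ (λ x → proj₁ ∘ missing⇒) (trans ∣b∣≡v (sym ∣s∣≡v))
        centre-missed : ∀ x → s x ≡ true → adj G x b ≡ false
        centre-missed x sx = proj₂ (proj₂ (missing⇒ (all-miss x sx)))
        others : ∀ x y → s x ≡ true → s y ≡ false → y ≢ b → adj G x y ≡ true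
        others x y sx sy y≢b with missing x y in mxy
        ... | true  = contradiction (missed-once (all-miss x sx) mxy) y≢b
        ... | false = ¬missing⇒adj sx sy mxy

      module PartialStar {b k} (∣b∣≡1+k : missingTo b ≡ suc k) where

        b-missed : 0 < missingTo b
        b-missed = subst (0 <_) (sym ∣b∣≡1+k) (s≤s z≤n)

        sb : s b ≡ false
        sb = missed⇒∁s b-missed

        I : Fin N → Bool
        I = proj₁ (∃-unmissed-subset sb ∣b∣≡1+k)

        I-unmissed : ∀ {y} → I y ≡ true → (s y ≡ false × y ≢ b) × missingTo y ≡ 0
        I-unmissed {y} Iy =
          let free = proj₁ (proj₂ (∃-unmissed-subset sb ∣b∣≡1+k)) y Iy
              other = ∧-conicalˡ _ _ free
          in (not≡true⇒false (∧-conicalˡ _ _ other) ,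
              λ { refl → contradiction (trans (cong not (sym (==-refl y))) (∧-conicalʳ _ _ other)) λ () })
             , does⇒ (missingTo y ℕ.≟ 0) (∧-conicalʳ _ _ free)

        adjacent : Fin N → Bool
        adjacent x = s x ∧ adj G x b

        t : Fin N → Bool
        t x = adjacent x ∨ ((x == b) ∨ I x)

        t-on-s : ∀ {x} → s x ≡ true → t x ≡ adj G x b
        t-on-s {x} sx rewrite sx | ==-≢ (true≢false s sx sb) with I x in Ix
        ... | false = ∨-identityʳ _
        ... | true  = contradiction (trans (sym sx) (proj₁ (proj₁ (I-unmissed Ix)))) λ ()

        t-on-∁s : ∀ {y} → s y ≡ false → t y ≡ (y == b) ∨ I y
        t-on-∁s sy rewrite sy = refl

        ∣t∣≡v : count t ≡ v
        ∣t∣≡v = begin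
          count t                                        ≡⟨ count-∨-⊆ (λ x → ∧-conicalˡ _ _) b-or-I-on-∁s ⟩
          count adjacent + count (λ x → (x == b) ∨ I x)  ≡⟨ cong (count adjacent +_)
                                                                 (count-∨ (_== b) I b-not-I) ⟩
          count adjacent + (count (_== b) + count I)     ≡⟨ cong (λ c → count adjacent + (c + count I))
                                                                 (count-singleton b) ⟩
          count adjacent + suc (count I)                 ≡⟨ cong (λ c → count adjacent + suc c)
                                                                 (proj₂ (proj₂ (∃-unmissed-subset sb ∣b∣≡1+k))) ⟩
          count adjacent + suc k                         ≡⟨ cong (count adjacent +_) ∣b∣≡1+k ⟨
          count adjacent + missingTo b                   ≡⟨ count-adjacent+missingTo sb ⟩
          v                                              ∎
          where
          open ≡-Reasoning
          b-not-I : ∀ x → (x == b) ∧ I x ≡ false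
          b-not-I x with x ≟ b | I x in Ix
          ... | _        | false = ∧-zeroʳ _
          ... | no  _    | true  = refl
          ... | yes refl | true  = contradiction refl (proj₂ (proj₁ (I-unmissed Ix)))
          b-or-I-on-∁s : (λ x → (x == b) ∨ I x) ⊆ ∁ s
          b-or-I-on-∁s x b∨I with x ≟ b | I x in Ix
          ... | yes refl | _    = cong not sb
          ... | no  _    | true = cong not (proj₁ (proj₁ (I-unmissed Ix)))

        compatible : CrossCompatible s t
        compatible x y sx sy tx≡ty = by-cases (trans (sym (t-on-s sx)) (trans tx≡ty (t-on-∁s sy)))
          where
          by-cases : adj G x b ≡ (y == b) ∨ I y → adj G x y ≡ true
          by-cases xb⇔y∈t with y ≟ b
          ... | yes refl = xb⇔y∈t
          ... | no  y≢b with I y in Iy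
          ...   | true  = ¬missing⇒adj sx sy (count≡0⇒false _ (proj₂ (I-unmissed Iy)) x)
          ...   | false with missing x y in mxy
          ...     | true  = contradiction (missed-once (¬adj⇒missing sx sb xb⇔y∈t) mxy) y≢b
          ...     | false = ¬missing⇒adj sx sy mxy

      partially-missed-⊥ : ∀ {b k} → missingTo b ≡ suc k → suc k ≢ v → ⊥
      partially-missed-⊥ {b} ∣b∣≡1+k 1+k≢v =
        compatible-cannot-separate t ∣t∣≡v compatible (trans sa₁ (sym sa₂))
          (trans (t-on-s sa₁) (∧-conicalʳ _ _ (proj₂ a₁-adjacent)))
          (trans (t-on-s sa₂) (proj₂ (proj₂ (missing⇒ (proj₂ a₂-missing)))))
        where
        open PartialStar ∣b∣≡1+k
        a₁-adjacent : ∃ λ a → adjacent a ≡ true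
        a₁-adjacent = count>0⇒∃ adjacent (ℕ.n≢0⇒n>0 λ #adj≡0 →
          1+k≢v (trans (sym ∣b∣≡1+k)
                       (trans (cong (_+ missingTo b) (sym #adj≡0)) (count-adjacent+missingTo sb))))
        a₂-missing : ∃ λ a → missing a b ≡ true
        a₂-missing = count>0⇒∃ (λ x → missing x b) b-missed
        sa₁ = ∧-conicalˡ _ _ (proj₂ a₁-adjacent)
        sa₂ = proj₁ (missing⇒ (proj₂ a₂-missing))

      starBisection : StarBisection v
      starBisection with ∃-missed
      ... | b , b-missed with missingTo b in ∣b∣ | b-missed
      ...   | suc k | _ with suc k ℕ.≟ v
      ...     | no  1+k≢v = ⊥-elim (partially-missed-⊥ ∣b∣ 1+k≢v)
      ...     | yes 1+k≡v = record
        { side        = ∁ s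
        ; centre      = b
        ; bisection   = IsBisection-∁ bis
        ; centre-side = cong not (missed⇒∁s b-missed)
        ; star        = fully-missed⇒star (missed⇒∁s b-missed) (trans ∣b∣ 1+k≡v)
        }

  uniqueBisection⇒StarBisection : ∀ {v s} → 2 ≤ v → IsBisection v s →
                                  (∀ t → IsBisection v t → SameSides s t) →
                                  Across.crossNonEdges s ≡ v → StarBisection v
  uniqueBisection⇒StarBisection {v} {s} 2≤v bis unique cross≡v
    with any? (λ a → (s a Bool.≟ true) ×-dec (Across.missingFrom s a ℕ.≟ 0))
  ... | no ∄a = UniqueBisection.starBisection 2≤v bis unique cross≡v
                  (λ x sx → ℕ.n≢0⇒n>0 λ ∣x∣≡0 → ∄a (x , sx , ∣x∣≡0))
  ... | yes (a , sa , ∣a∣≡0) with any? (λ b → (s b Bool.≟ false) ×-dec (Across.missingTo s b ℕ.≟ 0))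
  ...   | yes (b , sb , ∣b∣≡0) =
    ⊥-elim (UniqueBisection.unmissed-pair-⊥ 2≤v bis unique cross≡v sa ∣a∣≡0 sb ∣b∣≡0)
  ...   | no ∄b =
    UniqueBisection.starBisection 2≤v (IsBisection-∁ bis) unique-∁ (trans (crossNonEdges-∁ s) cross≡v)
                                  missing-from-all
    where
    unique-∁ : ∀ t → IsBisection v t → SameSides (∁ s) t
    unique-∁ t t-bis x y ∁sx≡∁sy = unique t t-bis x y (not-injective ∁sx≡∁sy)
    missing-from-all : ∀ x → ∁ s x ≡ true → 0 < Across.missingFrom (∁ s) x
    missing-from-all x ∁sx = subst (0 <_) (sym (count-cong (missing-∁ s x)))
                                   (ℕ.n≢0⇒n>0 λ ∣x∣≡0 → ∄b (x , not≡true⇒false ∁sx , ∣x∣≡0))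

-- The isomorphism with Γ′(2,v)

module StarIsomorphism {v : ℕ} {G : Graph (Fin (2 * v))} (star-bisection : StarBisection G v) where
  open StarBisection star-bisection renaming (side to S; centre to c)
  open IsBisection bisection

  -- The centre gets key 0, so it comes first on its side: its position is 0, as for (0,0) in Γ′.
  key : Fin (2 * v) → ℕ
  key x = if x == c then 0 else suc (toℕ x)

  key-c : key c ≡ 0
  key-c rewrite ==-refl c = refl

  key-c<key : ∀ {x} → x ≢ c → key c < key x
  key-c<key {x} x≢c rewrite key-c | ==-≢ x≢c = s≤s z≤n

  key-injective : Injective _≡_ _≡_ key
  key-injective {x} {y} kx≡ky with x ≟ c | y ≟ c
  ... | yes x≡c | yes y≡c = trans x≡c (sym y≡c)
  ... | no  _   | no  _   = toℕ-injective (ℕ.suc-injective kx≡ky)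

  open Rank S key key-injective

  rank<v : ∀ x → rank x < v
  rank<v x = subst (rank x <_) (∣side∣≡v (S x) refl) (rank<∣side∣ x)
    where
    ∣side∣≡v : ∀ b → S x ≡ b → count (λ z → sameSide z x) ≡ v
    ∣side∣≡v true  sx rewrite sx = trans (count-cong (does-≟-true ∘ S)) ∣s∣≡v
    ∣side∣≡v false sx rewrite sx = trans (count-cong (does-≟-false ∘ S)) ∣∁s∣≡v

  rank≡0⇔centre : ∀ {x} → S x ≡ true → rank x ≡ 0 ⇔ x ≡ c
  rank≡0⇔centre {x} sx = mk⇔
    (λ rx≡0 → decidable-stable (x ≟ c) λ x≢c →
       contradiction rx≡0 (ℕ.>⇒≢ (rank>0 (key-c<key x≢c) (trans centre-side (sym sx)))))
    (λ { refl → rank≡0 key-c })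

  position : Fin (2 * v) → Fin v
  position x = fromℕ< (rank<v x)

  σ : Fin (2 * v) → Fin 2 × Fin v
  σ x = sideIndex (S x) , position x

  σ-injective : Injective _≡_ _≡_ σ
  σ-injective {x} {y} σx≡σy = rank-injective (sideIndex-injective (cong proj₁ σx≡σy))
                                             (fromℕ<-injective _ _ (rank<v x) (rank<v y) (cong proj₂ σx≡σy))

  σ-== : ∀ x y → does (sideIndex (S x) ≟ sideIndex (S y)) ∧ does (position x ≟ position y) ≡ (x == y)
  σ-== x y = does-⇔ (mk⇔ (λ (i≡ , p≡) → σ-injective (cong₂ _,_ i≡ p≡)) λ { refl → refl , refl })
                    ((sideIndex (S x) ≟ sideIndex (S y)) ×-dec (position x ≟ position y)) (x ≟ y)

  σ-removed : ∀ x y → does (toℕ (position x) ℕ.≟ 0) ∧ does (toℕ (sideIndex (S x)) <? toℕ (sideIndex (S y)))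
                      ≡ (x == c ∧ not (S y))
  σ-removed x y = trans
    (does-⇔ (mk⇔ to from) ((toℕ (position x) ℕ.≟ 0) ×-dec (toℕ (sideIndex (S x)) <? toℕ (sideIndex (S y))))
                          ((x ≟ c) ×-dec (S y Bool.≟ false)))
    (cong (x == c ∧_) (does-≟-false (S y)))
    where
    to : toℕ (position x) ≡ 0 × toℕ (sideIndex (S x)) < toℕ (sideIndex (S y)) → x ≡ c × S y ≡ false
    to (px≡0 , x<y) = let sx , sy = Equivalence.to sideIndex-<⇔ x<y in
      Equivalence.to (rank≡0⇔centre sx) (trans (sym (toℕ-fromℕ< (rank<v x))) px≡0) , sy
    from : x ≡ c × S y ≡ false → toℕ (position x) ≡ 0 × toℕ (sideIndex (S x)) < toℕ (sideIndex (S y))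
    from (refl , sy) =
      trans (toℕ-fromℕ< (rank<v c)) (rank≡0 key-c) , Equivalence.from sideIndex-<⇔ (centre-side , sy)

  iso : Fin (2 * v) ↔ (Fin 2 × Fin v)
  iso = injective⇒↔ *↔× σ σ-injective

  adj≡Γ′ : ∀ x y → adj G x y ≡ adjΓ' {2} {v} (σ x) (σ y)
  adj≡Γ′ x y = trans (star x y)
    (sym (cong₂ (λ e r → not e ∧ not r) (σ-== x y) (cong₂ _∨_ (σ-removed x y) (σ-removed y x))))

-- Clique partitions and maximality

module _ {v : ℕ} {G : Graph (Fin (2 * v))} where

  ∣part∣≡count : (part : Fin (2 * v) → Fin 2) (i : Fin 2) →
                 length (filter (λ x → part x ≟ i) (allFin (2 * v))) ≡ count (λ x → part x == i)
  ∣part∣≡count part i = length-filter-tabulate id (λ x → part x ≟ i)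

  partition⇒IsBisection : (P : CliquePartition 2 v G) → IsBisection G v (λ x → part P x == fzero)
  partition⇒IsBisection P = record
    { ∣s∣≡v   = trans (sym (∣part∣≡count (part P) fzero)) (partSize P fzero)
    ; ∣∁s∣≡v  = trans (count-cong (not-==0 ∘ part P))
                      (trans (sym (∣part∣≡count (part P) (fsuc fzero))) (partSize P (fsuc fzero)))
    ; cliques = λ x y x≢y e → isClique P x y x≢y (==0-injective e)
    }

  IsBisection⇒partition : ∀ {t} → IsBisection G v t → CliquePartition 2 v G
  IsBisection⇒partition {t} bis = record
    { part     = sideIndex ∘ t
    ; partSize = λ { fzero        → trans (∣part∣≡count (sideIndex ∘ t) fzero)
                                          (trans (count-cong (sideIndex-==0 ∘ t)) ∣s∣≡v)
                   ; (fsuc fzero) → trans (∣part∣≡count (sideIndex ∘ t) (fsuc fzero))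
                                          (trans (count-cong (sideIndex-==1 ∘ t)) ∣∁s∣≡v) }
    ; isClique = λ x y x≢y e → cliques x y x≢y (sideIndex-injective e)
    }
    where open IsBisection bis

n≤[1+n]C2 : ∀ n → n ≤ suc n C 2
n≤[1+n]C2 n = subst (n ≤_) (trans (cong (_+ n C 2) (sym (nC1≡n n))) (nCk+nC[k+1]≡[n+1]C[k+1] n 1))
                          (ℕ.m≤m+n n (n C 2))

v≤[2v]C2 : ∀ v → v ≤ (2 * v) C 2
v≤[2v]C2 zero    = z≤n
v≤[2v]C2 (suc u) = ℕ.≤-trans 1+u≤u+1+u (n≤[1+n]C2 (u + suc (u + 0)))
  where
  1+u≤u+1+u : suc u ≤ u + suc (u + 0)
  1+u≤u+1+u = subst (λ w → suc u ≤ u + suc w) (sym (ℕ.+-identityʳ u)) (ℕ.m≤n+m (suc u) u)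

nonEdgeCount-of-edgeCount : ∀ {N m} (G : Graph (Fin N)) → edgeCount G ≡ N C 2 ∸ m → m ≤ N C 2 →
                            nonEdgeCount G ≡ m
nonEdgeCount-of-edgeCount {N} {m} G #edges m≤C = begin
  nonEdgeCount G                             ≡⟨ ℕ.m+n∸m≡n (edgeCount G) (nonEdgeCount G) ⟨
  edgeCount G + nonEdgeCount G ∸ edgeCount G ≡⟨ cong₂ _∸_ (edgeCount+nonEdgeCount G) #edges ⟩
  N C 2 ∸ (N C 2 ∸ m)                        ≡⟨ ℕ.m∸[m∸n]≡n m≤C ⟩
  m                                          ∎
  where open ≡-Reasoning

theorem3p3 : (v : ℕ) → 2 ≤ v → (G : Graph (Fin (2 * v))) →
    MaximalWeaklyCliquePartitioned 2 v G →
    Isomorphic G (adjΓ' {2} {v})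
theorem3p3 v 2≤v G ((P , P-unique) , #edges) = iso , adj≡Γ′
  where
  s : Fin (2 * v) → Bool
  s x = part P x == fzero
  bis : IsBisection G v s
  bis = partition⇒IsBisection P
  unique : ∀ t → IsBisection G v t → SameSides G s t
  unique t t-bis x y sx≡sy =
    sideIndex-injective (proj₁ (P-unique (IsBisection⇒partition t-bis) x y) (==0-injective sx≡sy))
  v-non-edges : nonEdgeCount G ≡ v
  v-non-edges = nonEdgeCount-of-edgeCount G
    (trans #edges (cong ((2 * v) C 2 ∸_) (trans (cong (_/ 2) (ℕ.*-comm 2 v)) (m*n/n≡m v 2))))
    (v≤[2v]C2 v)
  open StarIsomorphism (uniqueBisection⇒StarBisection G 2≤v bis unique
    (trans (sym (Across.nonEdgeCount≡crossNonEdges G s (IsBisection.cliques bis))) v-non-edges))
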